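{- Let $k\ge 2$ and let $c:\mathbb{N}\to\{R,G,B\}$ be rainbow-free for $x-y=z^k$ and satisfy \[\limsup_{n\to\infty}\Big(\min\{\mathcal{R}(n),\mathcal{B}(n),\mathcal{G}(n)\}-\frac{n}{n_0}\Big)=\infty\] for some integer $n_0\ge 2$. Then there is a constant $L$ such that every monochromatic string whose color is not a dominant color has length at most $L$.
   Context: Here $\mathbb{N}=\{1,2,\dots\}$; $\mathcal{R},\mathcal{B},\mathcal{G}$ are the color classes and $S(n)=|S\cap\{1,\dots,n\}|$. A rainbow solution to $x-y=z^k$ is an ordered triple $(a_1,a_2,a_3)$ of positive integers with $a_1-a_2=a_3^k$ and $c(a_1),c(a_2),c(a_3)$ pairwise distinct; rainbow-free means none exists. A string of length $\ell$ at position $i$ is $\{i,\dots,i+\ell-1\}$; it is monochromatic if all elements share a color and bichromatic if it contains exactly two colors. A color is dominant if every bichromatic string contains an element of that color. -}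

module Defs where

open import Data.Nat using (ℕ; zero; suc; _+_; _*_; _^_; _≤_; _<_; _⊓_)
open import Data.Sum using (_⊎_)
open import Data.Product using (Σ; ∃; ∃-syntax; _×_; _,_)
open import Relation.Nullary using (¬_; Dec; yes; no)
open import Relation.Binary.PropositionalEquality using (_≡_; _≢_; refl)

data Color : Set where
  R G B : Color

_≟ᶜ_ : (x y : Color) → Dec (x ≡ y)
R ≟ᶜ R = yes refl
R ≟ᶜ G = no λ ()
R ≟ᶜ B = no λ ()
G ≟ᶜ R = no λ ()
G ≟ᶜ G = yes refl
G ≟ᶜ B = no λ ()
B ≟ᶜ R = no λ ()
B ≟ᶜ G = no λ ()
B ≟ᶜ B = yes refl

-- A coloring of the positive integers; the value at 0 is irrelevant
-- (0 never occurs in any of the definitions below).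
Coloring : Set
Coloring = ℕ → Color

Rainbow : Color → Color → Color → Set
Rainbow x y z = x ≢ y × x ≢ z × y ≢ z

-- Rainbow-free for x - y = z^k: no positive a₁ a₂ a₃ with a₁ - a₂ = a₃^k
-- (i.e. a₁ = a₂ + a₃^k) whose colors are pairwise distinct.
RainbowFree : ℕ → Coloring → Set
RainbowFree k c = ∀ a₁ a₂ a₃ → 1 ≤ a₁ → 1 ≤ a₂ → 1 ≤ a₃ →
  a₁ ≡ a₂ + a₃ ^ k → ¬ Rainbow (c a₁) (c a₂) (c a₃)

count : Coloring → Color → ℕ → ℕ
count c col zero = zero
count c col (suc n) with c (suc n) ≟ᶜ col
... | yes _ = suc (count c col n)
... | no  _ = count c col n

minCount : Coloring → ℕ → ℕ
minCount c n = (count c R n ⊓ count c B n) ⊓ count c G n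

-- limsup_{n→∞} (min{R(n),B(n),G(n)} - n/n₀) = ∞, for n₀ ≥ 1:
-- for every bound M and every N there is n ≥ N with
-- min{…} - n/n₀ > M, i.e. n + n₀·M < n₀ · min{…}.
LimsupInfinite : Coloring → ℕ → Set
LimsupInfinite c n₀ = ∀ (M N : ℕ) → ∃[ n ] (N ≤ n × n + n₀ * M < n₀ * minCount c n)

InString : ℕ → ℕ → ℕ → Set
InString i ℓ j = i ≤ j × j < i + ℓ

MonochromaticOf : Coloring → Color → ℕ → ℕ → Set
MonochromaticOf c col i ℓ = ∀ j → InString i ℓ j → c j ≡ col

Bichromatic : Coloring → ℕ → ℕ → Set
Bichromatic c i ℓ = ∃[ x ] ∃[ y ] (x ≢ y ×
  (∀ j → InString i ℓ j → (c j ≡ x ⊎ c j ≡ y)) ×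
  (∃[ j ] (InString i ℓ j × c j ≡ x)) ×
  (∃[ j ] (InString i ℓ j × c j ≡ y)))

Dominant : Coloring → Color → Set
Dominant c d = ∀ i ℓ → 1 ≤ i → Bichromatic c i ℓ →
  ∃[ j ] (InString i ℓ j × c j ≡ d)

{-# OPTIONS --safe #-}
-- Since a + 1 = a + 1ᵏ, two consecutive integers of different colors must
-- use the color of 1 between them; hence a string avoiding that color is
-- monochromatic, and c 1 is dominant.  For any other color col pick z of the
-- third color: all colors occur below some n, because the minimal color
-- count is eventually positive.  A col-string of length ≥ zᵏ starting at
-- p + 1 cannot be preceded by c 1, as (p + zᵏ, p, z) would be rainbow, so by
-- the adjacency rule it extends to the left all the way down to 1,
-- contradicting col ≢ c 1.  Thus every such string is shorter than zᵏ ≤ nᵏ.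
module Submission where

open import Defs
open import Data.Nat using (ℕ; zero; suc; _+_; _*_; _^_; _≤_; _<_; z≤n; s≤s; z<s;
  ≢-nonZero; >-nonZero; >-nonZero⁻¹)
open import Data.Nat.Properties
open import Data.Product using (∃-syntax; _,_; _×_)
open import Data.Sum using (_⊎_; inj₁; inj₂; [_,_]′)
open import Data.Empty using (⊥; ⊥-elim)
open import Relation.Nullary using (¬_; yes; no)
open import Relation.Binary.Definitions using (DecidableEquality)
open import Relation.Binary.PropositionalEquality using (_≡_; _≢_; refl; sym; trans; subst; cong)

otherColor : (a b : Color) → ∃[ y ] (y ≢ a × y ≢ b)
otherColor R R = G , (λ ()) , (λ ())
otherColor R G = B , (λ ()) , (λ ())
otherColor R B = G , (λ ()) , (λ ())
otherColor G R = B , (λ ()) , (λ ())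
otherColor G G = R , (λ ()) , (λ ())
otherColor G B = R , (λ ()) , (λ ())
otherColor B R = G , (λ ()) , (λ ())
otherColor B G = R , (λ ()) , (λ ())
otherColor B B = R , (λ ()) , (λ ())

¬Rainbow⇒coincidence : ∀ {x y z} → ¬ Rainbow x y z → x ≡ y ⊎ x ≡ z ⊎ y ≡ z
¬Rainbow⇒coincidence {x} {y} {z} ¬rainbow with x ≟ᶜ y | x ≟ᶜ z | y ≟ᶜ z
... | yes x≡y | _       | _       = inj₁ x≡y
... | no _    | yes x≡z | _       = inj₂ (inj₁ x≡z)
... | no _    | no _    | yes y≡z = inj₂ (inj₂ y≡z)
... | no x≢y  | no x≢z  | no y≢z  = ⊥-elim (¬rainbow (x≢y , x≢z , y≢z))

module _ {A : Set} (_≟_ : DecidableEquality A) (f : ℕ → A) where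

  changePoint : ∀ m d → f m ≢ f (m + d) →
    ∃[ a ] (m ≤ a × a < m + d × f a ≢ f (suc a))
  changePoint m zero fm≢ = ⊥-elim (fm≢ (cong f (sym (+-identityʳ m))))
  changePoint m (suc d) fm≢ with f m ≟ f (suc m)
  ... | no fm≢fsm = m , ≤-refl , m<m+n m z<s , fm≢fsm
  ... | yes fm≡fsm with changePoint (suc m) d
                          (λ e → fm≢ (trans fm≡fsm (trans e (cong f (sym (+-suc m d))))))
  ...   | a , m<a , a< , fa≢ = a , ≤-trans (n≤1+n m) m<a , subst (a <_) (sym (+-suc m d)) a< , fa≢

inString-offset : ∀ i {d ℓ : ℕ} → 1 ≤ d → d ≤ ℓ → InString (suc i) ℓ (i + d)
inString-offset i {d} 1≤d d≤ℓ =
  subst (_≤ i + d) (+-comm i 1) (+-monoʳ-≤ i 1≤d) , s≤s (+-monoʳ-≤ i d≤ℓ)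

inString-start : ∀ {i ℓ} → 1 ≤ ℓ → InString i ℓ i
inString-start {i} 1≤ℓ = ≤-refl , m<m+n i 1≤ℓ

monochromatic-extendˡ : ∀ {c col i ℓ} → c i ≡ col →
  MonochromaticOf c col (suc i) ℓ → MonochromaticOf c col i (suc ℓ)
monochromatic-extendˡ {i = i} {ℓ} ci≡col mono j (i≤j , j<) with m≤n⇒m<n∨m≡n i≤j
... | inj₂ refl = ci≡col
... | inj₁ i<j  = mono j (i<j , subst (j <_) (+-suc i ℓ) j<)

module _ (k : ℕ) (c : Coloring) (rf : RainbowFree k c) where

  successor-rainbowFree : ∀ a → 1 ≤ a → ¬ Rainbow (c (suc a)) (c a) (c 1)
  successor-rainbowFree a 1≤a = rf (suc a) a 1 (s≤s z≤n) 1≤a ≤-refl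
    (trans (+-comm 1 a) (cong (a +_) (sym (^-zeroˡ k))))

  predecessor-color : ∀ a → 1 ≤ a → c (suc a) ≢ c 1 → c a ≡ c (suc a) ⊎ c a ≡ c 1
  predecessor-color a 1≤a csa≢first with ¬Rainbow⇒coincidence (successor-rainbowFree a 1≤a)
  ... | inj₁ csa≡ca = inj₁ (sym csa≡ca)
  ... | inj₂ (inj₁ csa≡first) = ⊥-elim (csa≢first csa≡first)
  ... | inj₂ (inj₂ ca≡first) = inj₂ ca≡first

  avoidingFirst⇒constant : ∀ {i ℓ j₁ j₂} → 1 ≤ i → (∀ j → InString i ℓ j → c j ≢ c 1) →
    InString i ℓ j₁ → InString i ℓ j₂ → j₁ ≤ j₂ → c j₁ ≡ c j₂
  avoidingFirst⇒constant {i} {ℓ} {j₁} {j₂} 1≤i avoids (i≤j₁ , _) (_ , j₂<) j₁≤j₂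
    with c j₁ ≟ᶜ c j₂ | m≤n⇒∃[o]m+o≡n j₁≤j₂
  ... | yes cj₁≡cj₂ | _ = cj₁≡cj₂
  ... | no cj₁≢cj₂ | d , refl with changePoint _≟ᶜ_ c j₁ d cj₁≢cj₂
  ...   | a , j₁≤a , a<j₂ , ca≢csa = ⊥-elim (successor-rainbowFree a (≤-trans 1≤i i≤a)
      ((λ e → ca≢csa (sym e)) , avoids (suc a) (≤-trans i≤a (n≤1+n a) , ≤-<-trans a<j₂ j₂<)
                              , avoids a (i≤a , <-trans a<j₂ j₂<)))
    where
    i≤a : i ≤ a
    i≤a = ≤-trans i≤j₁ j₁≤a

  firstColor-dominant : Dominant c (c 1)
  firstColor-dominant i ℓ 1≤i (x , y , x≢y , twoColors , (j₁ , j₁∈ , cj₁) , (j₂ , j₂∈ , cj₂))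
    with x ≟ᶜ c 1 | y ≟ᶜ c 1
  ... | yes x≡first | _ = j₁ , j₁∈ , trans cj₁ x≡first
  ... | no _ | yes y≡first = j₂ , j₂∈ , trans cj₂ y≡first
  ... | no x≢first | no y≢first = ⊥-elim (x≢y (trans (sym cj₁) (trans cj₁≡cj₂ cj₂)))
    where
    avoids : ∀ j → InString i ℓ j → c j ≢ c 1
    avoids j j∈ with twoColors j j∈
    ... | inj₁ cj≡x = λ e → x≢first (trans (sym cj≡x) e)
    ... | inj₂ cj≡y = λ e → y≢first (trans (sym cj≡y) e)
    cj₁≡cj₂ : c j₁ ≡ c j₂
    cj₁≡cj₂ with ≤-total j₁ j₂
    ... | inj₁ j₁≤j₂ = avoidingFirst⇒constant 1≤i avoids j₁∈ j₂∈ j₁≤j₂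
    ... | inj₂ j₂≤j₁ = sym (avoidingFirst⇒constant 1≤i avoids j₂∈ j₁∈ j₂≤j₁)

  module _ {col : Color} (col≢first : col ≢ c 1)
           {z : ℕ} (1≤z : 1 ≤ z) (cz≢col : c z ≢ col) (cz≢first : c z ≢ c 1) where

    1≤zᵏ : 1 ≤ z ^ k
    1≤zᵏ = m^n>0 z {{>-nonZero 1≤z}} k

    ¬longMonochromatic : ∀ p ℓ → z ^ k ≤ ℓ → ¬ MonochromaticOf c col (suc p) ℓ
    ¬longMonochromatic zero ℓ zᵏ≤ℓ mono =
      col≢first (sym (mono 1 (inString-start (≤-trans 1≤zᵏ zᵏ≤ℓ))))
    ¬longMonochromatic (suc q) ℓ zᵏ≤ℓ mono =
      [ extended , precededByFirst ]′
        (predecessor-color (suc q) (s≤s z≤n) (λ e → col≢first (trans (sym start≡col) e)))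
      where
      start≡col : c (suc (suc q)) ≡ col
      start≡col = mono (suc (suc q)) (inString-start (≤-trans 1≤zᵏ zᵏ≤ℓ))

      extended : c (suc q) ≡ c (suc (suc q)) → ⊥
      extended e = ¬longMonochromatic q (suc ℓ) (≤-trans zᵏ≤ℓ (n≤1+n ℓ))
        (monochromatic-extendˡ (trans e start≡col) mono)

      c[q+zᵏ]≡col : c (suc q + z ^ k) ≡ col
      c[q+zᵏ]≡col = mono (suc q + z ^ k) (inString-offset (suc q) 1≤zᵏ zᵏ≤ℓ)

      precededByFirst : c (suc q) ≡ c 1 → ⊥
      precededByFirst cq≡first = rf (suc q + z ^ k) (suc q) z (s≤s z≤n) (s≤s z≤n) 1≤z refl
        ( (λ e → col≢first (trans (sym c[q+zᵏ]≡col) (trans e cq≡first)))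
        , (λ e → cz≢col (trans (sym e) c[q+zᵏ]≡col))
        , (λ e → cz≢first (trans (sym e) cq≡first)) )

    monochromatic-shorter : ∀ p ℓ → MonochromaticOf c col (suc p) ℓ → ℓ < z ^ k
    monochromatic-shorter p ℓ mono = ≰⇒> (λ zᵏ≤ℓ → ¬longMonochromatic p ℓ zᵏ≤ℓ mono)

count-pos⇒occurs : ∀ c col n → 1 ≤ count c col n → ∃[ z ] (1 ≤ z × z ≤ n × c z ≡ col)
count-pos⇒occurs c col (suc n) 1≤count with c (suc n) ≟ᶜ col
... | yes e = suc n , s≤s z≤n , ≤-refl , e
... | no _ with count-pos⇒occurs c col n 1≤count
...   | z , 1≤z , z≤bound , cz = z , 1≤z , ≤-trans z≤bound (n≤1+n n) , cz

minCount≤count : ∀ c n col → minCount c n ≤ count c col n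
minCount≤count c n R = ≤-trans (m⊓n≤m _ _) (m⊓n≤m _ _)
minCount≤count c n B = ≤-trans (m⊓n≤m _ _) (m⊓n≤n _ _)
minCount≤count c n G = m⊓n≤n _ _

<*⇒factor-pos : ∀ a b m → a < b * m → 1 ≤ m
<*⇒factor-pos a b m a<bm = >-nonZero⁻¹ m {{m*n≢0⇒n≢0 b {{≢-nonZero (m<n⇒n≢0 a<bm)}}}}

mainTheorem11 : (k : ℕ) → 2 ≤ k → (c : Coloring) → RainbowFree k c →
    (n₀ : ℕ) → 2 ≤ n₀ → LimsupInfinite c n₀ →
    ∃[ L ] (∀ (col : Color) (i ℓ : ℕ) → 1 ≤ i → MonochromaticOf c col i ℓ →
      ¬ Dominant c col → ℓ ≤ L)
mainTheorem11 k _ c rf n₀ _ limsup with limsup 0 0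
... | n , _ , n<n₀*min = n ^ k , bound
  where
  occurs : ∀ col → ∃[ z ] (1 ≤ z × z ≤ n × c z ≡ col)
  occurs col = count-pos⇒occurs c col n
    (≤-trans (<*⇒factor-pos _ n₀ _ n<n₀*min) (minCount≤count c n col))

  bound : ∀ col i ℓ → 1 ≤ i → MonochromaticOf c col i ℓ → ¬ Dominant c col → ℓ ≤ n ^ k
  bound col (suc p) ℓ _ mono ¬dominant with otherColor col (c 1)
  ... | y , y≢col , y≢first with occurs y
  ...   | z , 1≤z , z≤bound , cz≡y =
    <⇒≤ (≤-trans (monochromatic-shorter k c rf col≢first 1≤z
                   (λ e → y≢col (trans (sym cz≡y) e)) (λ e → y≢first (trans (sym cz≡y) e)) p ℓ mono)
                 (^-monoˡ-≤ k z≤bound))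
    where
    col≢first : col ≢ c 1
    col≢first col≡first = ¬dominant (subst (Dominant c) (sym col≡first) (firstColor-dominant k c rf))
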